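{- Let $g(x),f(x)$ be formal power series with integer coefficients and $g(0)=f(0)=1$, let $A=(g(x),xf(x))$ with entries $a_{n,k}=[x^n]g(x)(xf(x))^k$, and let $\phi(x)$ be the reversion of $x/f(x)$. For an integer $r\ge0$ let $c(A;r)$ be the lower-triangular matrix with $(n,k)$ entry $a_{2n+r,n+k+r}$. Then $$c(A;r)=\left(\frac{1}{\phi'\!\left(\frac{x}{f(x)}\right)f(x)^{r-1}},\ \frac{x}{f(x)}\right)^{ -1}\cdot A.$$
   Context: A Riordan array $(d(x),h(x))$, for formal power series $d,h$ with $d(0)\neq 0$, $h(0)=0$, $h'(0)\neq 0$, is the infinite lower-triangular matrix whose $(n,k)$ entry is $[x^n]d(x)h(x)^k$. Riordan arrays form a group under matrix multiplication, with $(d,h)\cdot(u,w)=(d(x)u(h(x)),w(h(x)))$ and $(d,h)^{ -1}=(1/d(\bar h),\bar h)$, where $\bar h$ is the reversion of $h$: the power series $u$ with $u(0)=0$ and $h(u(x))=x$. $\phi'$ denotes the derivative of $\phi$. -}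

module Defs where

open import Data.Nat as ℕ using (ℕ; zero; suc; _∸_; _<_)
open import Data.Integer as ℤ using (ℤ; +_; -[1+_])
open import Relation.Binary.PropositionalEquality using (_≡_)
open import Relation.Nullary using (yes; no)

Series : Set
Series = ℕ → ℤ

_≈ₛ_ : Series → Series → Set
a ≈ₛ b = ∀ n → a n ≡ b n

sumTo : ℕ → (ℕ → ℤ) → ℤ
sumTo zero    f = f zero
sumTo (suc n) f = sumTo n f ℤ.+ f (suc n)

one : Series
one zero    = + 1
one (suc _) = + 0

X : Series
X (suc zero) = + 1
X _          = + 0

_⊗_ : Series → Series → Series
(a ⊗ b) n = sumTo n (λ i → a i ℤ.* b (n ∸ i))

pow : Series → ℕ → Series
pow a zero    = one
pow a (suc k) = a ⊗ pow a k

powℤ : Series → Series → ℤ → Series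
powℤ f fInv (+ k)    = pow f k
powℤ f fInv -[1+ k ] = pow fInv (suc k)

-- Composition a(h(x)); meaningful (and used only) when h(0) = 0,
-- in which case [x^n] a(h) = Σ_{k ≤ n} a_k [x^n] h^k.
compose : Series → Series → Series
compose a h n = sumTo n (λ k → a k ℤ.* pow h k n)

deriv : Series → Series
deriv a n = (+ suc n) ℤ.* a (suc n)

-- Infinite matrices indexed by ℕ × ℕ (row n, column k).
Matrix : Set
Matrix = ℕ → ℕ → ℤ

Riordan : Series → Series → Matrix
Riordan d h n k = (d ⊗ pow h k) n

LowerTriangular : Matrix → Set
LowerTriangular P = ∀ n k → n < k → P n k ≡ + 0

-- Product of lower-triangular matrices (P lower triangular, so the sum
-- over j is finite: j ≤ n).
_·_ : Matrix → Matrix → Matrix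
(P · Q) n k = sumTo n (λ j → P n j ℤ.* Q j k)

Id : Matrix
Id n k with n ℕ.≟ k
... | yes _ = + 1
... | no  _ = + 0

_≈ₘ_ : Matrix → Matrix → Set
P ≈ₘ Q = ∀ n k → P n k ≡ Q n k

cMat : Matrix → ℕ → Matrix
cMat A r n k = A (2 ℕ.* n ℕ.+ r) (n ℕ.+ k ℕ.+ r)

-- The (n, k) entry of c(A; r) is [x^(2n+r)] g (x f)^(n+k+r) = [xⁿ] f^(n+1) Qₖ with
-- Qₖ = f^(r-1) g (x f)^k, so the k-th column of c(A; r) is the Lagrange matrix
-- ([x^(n-m)] f^(n+1)) applied to Qₖ.  For h = x / f, differentiating h f = x shows that this
-- matrix is inverse to the Riordan array (h′, h), which is Lagrange inversion in the form
-- h′(x) Σⱼ ([xʲ] f^(j+1) Q) h(x)ʲ = Q(x).  Hence the column series Cₖ satisfies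
-- h′ · Cₖ(h) = f^(r-1) g (x f)^k.  The chain rule applied to h(φ(x)) = x gives φ′(h) h′ = 1, so
-- d · Cₖ(h) = g (x f)^k for d = 1 / (φ′(h) f^(r-1)): that is, (d, h) · c(A; r) = A.

module Submission where

open import Defs
open import Data.Nat using (ℕ)
open import Data.Integer using (ℤ; +_; _-_)
open import Relation.Binary.PropositionalEquality using (_≡_)

open import Algebra.Bundles using (AbelianGroup; CommutativeMonoid)
open import Data.Empty using (⊥-elim)
open import Data.Product using (_,_)
open import Function using (_∘_)
open import Data.Integer using (_+_; _*_)
import Data.Integer.Properties as ℤₚ
open import Data.Integer.Tactic.RingSolver using (solve-∀)
import Data.Nat.Tactic.RingSolver as ℕSolver
open import Data.Nat as ℕ using (zero; suc; _∸_; _≤_; _<_; z≤n; s≤s)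
import Data.Nat.Properties as ℕₚ
open import Relation.Binary.Bundles using (Setoid)
open import Relation.Binary.PropositionalEquality
  using (refl; sym; trans; cong; cong₂; subst; module ≡-Reasoning)
open import Relation.Nullary using (¬_; Dec; yes; no)
import Relation.Binary.Reasoning.Setoid as SetoidReasoning

open import Algebra.Properties.Group (AbelianGroup.group ℤₚ.+-0-abelianGroup) using ()
  renaming (∙-cancelˡ to +-cancelˡ; ∙-cancelʳ to +-cancelʳ)

-- Finite sums

sumTo-cong : ∀ n {F G : ℕ → ℤ} → (∀ i → i ≤ n → F i ≡ G i) → sumTo n F ≡ sumTo n G
sumTo-cong zero    F≡G = F≡G zero z≤n
sumTo-cong (suc n) F≡G =
  cong₂ _+_ (sumTo-cong n (λ i i≤n → F≡G i (ℕₚ.m≤n⇒m≤1+n i≤n))) (F≡G (suc n) ℕₚ.≤-refl)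

sumTo-ext : ∀ n {F G : ℕ → ℤ} → (∀ i → F i ≡ G i) → sumTo n F ≡ sumTo n G
sumTo-ext n F≡G = sumTo-cong n (λ i _ → F≡G i)

sumTo-+ : ∀ n (F G : ℕ → ℤ) → sumTo n (λ i → F i + G i) ≡ sumTo n F + sumTo n G
sumTo-+ zero    F G = refl
sumTo-+ (suc n) F G = trans (cong (_+ (F (suc n) + G (suc n))) (sumTo-+ n F G))
                            (medial (sumTo n F) (sumTo n G) (F (suc n)) (G (suc n)))
  where
  medial : ∀ a b c d → (a + b) + (c + d) ≡ (a + c) + (b + d)
  medial = solve-∀

*-distribˡ-sumTo : ∀ n c (F : ℕ → ℤ) → c * sumTo n F ≡ sumTo n (λ i → c * F i)
*-distribˡ-sumTo zero    c F = refl
*-distribˡ-sumTo (suc n) c F = trans (ℤₚ.*-distribˡ-+ c (sumTo n F) (F (suc n)))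
                                     (cong (_+ c * F (suc n)) (*-distribˡ-sumTo n c F))

*-distribʳ-sumTo : ∀ n c (F : ℕ → ℤ) → sumTo n F * c ≡ sumTo n (λ i → F i * c)
*-distribʳ-sumTo n c F = trans (ℤₚ.*-comm (sumTo n F) c)
  (trans (*-distribˡ-sumTo n c F) (sumTo-ext n (λ i → ℤₚ.*-comm c (F i))))

sumTo-*-sumTo : ∀ n m (F G : ℕ → ℤ) →
  sumTo n F * sumTo m G ≡ sumTo n (λ i → sumTo m (λ j → F i * G j))
sumTo-*-sumTo n m F G = trans (*-distribʳ-sumTo n (sumTo m G) F)
                              (sumTo-ext n (λ i → *-distribˡ-sumTo m (F i) G))

sumTo-zero : ∀ n (F : ℕ → ℤ) → (∀ i → i ≤ n → F i ≡ + 0) → sumTo n F ≡ + 0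
sumTo-zero n F F≡0 = trans (sumTo-cong n F≡0) (sumTo-const-0 n)
  where
  sumTo-const-0 : ∀ n → sumTo n (λ _ → + 0) ≡ + 0
  sumTo-const-0 zero    = refl
  sumTo-const-0 (suc n) = trans (ℤₚ.+-identityʳ _) (sumTo-const-0 n)

sumTo-comm : ∀ n m (F : ℕ → ℕ → ℤ) →
  sumTo n (λ i → sumTo m (λ j → F i j)) ≡ sumTo m (λ j → sumTo n (λ i → F i j))
sumTo-comm zero    m F = refl
sumTo-comm (suc n) m F =
  trans (cong (_+ sumTo m (F (suc n))) (sumTo-comm n m F)) (sym (sumTo-+ m _ _))

sumTo-extend : ∀ {n m} (F : ℕ → ℤ) → n ≤ m → (∀ i → n < i → F i ≡ + 0) →
  sumTo m F ≡ sumTo n F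
sumTo-extend {n} {m} F n≤m F≡0 =
  subst (λ m → sumTo m F ≡ sumTo n F) (ℕₚ.m∸n+n≡m n≤m) (extend-by (m ∸ n))
  where
  extend-by : ∀ k → sumTo (k ℕ.+ n) F ≡ sumTo n F
  extend-by zero    = refl
  extend-by (suc k) = trans (cong₂ _+_ (extend-by k) (F≡0 _ (s≤s (ℕₚ.m≤n+m n k))))
                            (ℤₚ.+-identityʳ _)

sumTo-suc-head : ∀ n (F : ℕ → ℤ) → sumTo (suc n) F ≡ F 0 + sumTo n (λ i → F (suc i))
sumTo-suc-head zero    F = refl
sumTo-suc-head (suc n) F =
  trans (cong (_+ F (suc (suc n))) (sumTo-suc-head n F)) (ℤₚ.+-assoc (F 0) _ _)

sumTo-single : ∀ n p (F : ℕ → ℤ) → p ≤ n → (∀ i → ¬ i ≡ p → F i ≡ + 0) → sumTo n F ≡ F p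
sumTo-single zero    zero F z≤n F≡0 = refl
sumTo-single (suc n) p    F p≤n F≡0 with p ℕ.≟ suc n
... | yes refl = trans (cong (_+ F p) (sumTo-zero n F (λ i i≤n → F≡0 i (ℕₚ.<⇒≢ (s≤s i≤n)))))
                       (ℤₚ.+-identityˡ _)
... | no  p≢n  = trans (cong₂ _+_ (sumTo-single n p F (ℕₚ.≤-pred (ℕₚ.≤∧≢⇒< p≤n p≢n)) F≡0)
                                  (F≡0 (suc n) (p≢n ∘ sym)))
                       (ℤₚ.+-identityʳ _)

sumTo-reverse : ∀ n (F : ℕ → ℤ) → sumTo n F ≡ sumTo n (λ i → F (n ∸ i))
sumTo-reverse zero    F = refl
sumTo-reverse (suc n) F = begin
  sumTo n F + F (suc n)                       ≡⟨ cong (_+ F (suc n)) (sumTo-reverse n F) ⟩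
  sumTo n (λ i → F (n ∸ i)) + F (suc n)       ≡⟨ ℤₚ.+-comm _ (F (suc n)) ⟩
  F (suc n) + sumTo n (λ i → F (n ∸ i))       ≡⟨ sym (sumTo-suc-head n (λ i → F (suc n ∸ i))) ⟩
  sumTo (suc n) (λ i → F (suc n ∸ i))         ∎
  where open ≡-Reasoning

sumTo-triangle : ∀ n (F : ℕ → ℕ → ℤ) →
  sumTo n (λ k → sumTo k (λ i → F k i)) ≡ sumTo n (λ i → sumTo (n ∸ i) (λ j → F (i ℕ.+ j) i))
sumTo-triangle zero    F = refl
sumTo-triangle (suc n) F = begin
  sumTo n (λ k → sumTo k (F k)) + (sumTo n (F (suc n)) + F (suc n) (suc n))
    ≡⟨ cong (_+ (sumTo n (F (suc n)) + F (suc n) (suc n))) (sumTo-triangle n F) ⟩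
  sumTo n (λ i → column n i) + (sumTo n (F (suc n)) + F (suc n) (suc n))
    ≡⟨ sym (ℤₚ.+-assoc (sumTo n (column n)) (sumTo n (F (suc n))) (F (suc n) (suc n))) ⟩
  (sumTo n (λ i → column n i) + sumTo n (F (suc n))) + F (suc n) (suc n)
    ≡⟨ cong₂ _+_ (sym (sumTo-+ n _ _)) (cong (λ m → F m (suc n)) (sym (ℕₚ.+-identityʳ (suc n)))) ⟩
  sumTo n (λ i → column n i + F (suc n) i) + F (suc n ℕ.+ 0) (suc n)
    ≡⟨ cong₂ _+_ (sumTo-cong n (λ i i≤n → sym (column-suc i i≤n)))
                 (cong (λ m → sumTo m (λ j → F (suc n ℕ.+ j) (suc n))) (sym (ℕₚ.n∸n≡0 n))) ⟩
  sumTo (suc n) (λ i → column (suc n) i) ∎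
  where
  open ≡-Reasoning
  column : ℕ → ℕ → ℤ
  column n i = sumTo (n ∸ i) (λ j → F (i ℕ.+ j) i)
  column-suc : ∀ i → i ≤ n → column (suc n) i ≡ column n i + F (suc n) i
  column-suc i i≤n rewrite ℕₚ.+-∸-assoc 1 i≤n =
    cong (λ m → column n i + F m i) (trans (ℕₚ.+-suc i (n ∸ i)) (cong suc (ℕₚ.m+[n∸m]≡n i≤n)))

-- The ring of series

infixl 6 _+ₛ_

_+ₛ_ : Series → Series → Series
(a +ₛ b) n = a n + b n

scale : ℤ → Series → Series
scale c a n = c * a n

≈ₛ-setoid : Setoid _ _
≈ₛ-setoid = record
  { Carrier       = Series
  ; _≈_           = _≈ₛ_
  ; isEquivalence = record
    { refl  = λ _ → refl
    ; sym   = λ a≈b n → sym (a≈b n)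
    ; trans = λ a≈b b≈c n → trans (a≈b n) (b≈c n)
    }
  }

open Setoid ≈ₛ-setoid using ()
  renaming (refl to ≈ₛ-refl; sym to ≈ₛ-sym; trans to ≈ₛ-trans)
module ≈ₛ-Reasoning = SetoidReasoning ≈ₛ-setoid

⊗-cong : ∀ {a a′ b b′} → a ≈ₛ a′ → b ≈ₛ b′ → (a ⊗ b) ≈ₛ (a′ ⊗ b′)
⊗-cong a≈a′ b≈b′ n = sumTo-ext n (λ i → cong₂ _*_ (a≈a′ i) (b≈b′ (n ∸ i)))

⊗-congˡ : ∀ {a a′} b → a ≈ₛ a′ → (a ⊗ b) ≈ₛ (a′ ⊗ b)
⊗-congˡ b a≈a′ = ⊗-cong a≈a′ (≈ₛ-refl {b})

⊗-congʳ : ∀ a {b b′} → b ≈ₛ b′ → (a ⊗ b) ≈ₛ (a ⊗ b′)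
⊗-congʳ a b≈b′ = ⊗-cong (≈ₛ-refl {a}) b≈b′

⊗-comm : ∀ a b → (a ⊗ b) ≈ₛ (b ⊗ a)
⊗-comm a b n = trans (sumTo-reverse n _) (sumTo-cong n (λ i i≤n →
  trans (cong (λ j → a (n ∸ i) * b j) (ℕₚ.m∸[m∸n]≡n i≤n)) (ℤₚ.*-comm (a (n ∸ i)) (b i))))

⊗-assoc : ∀ a b c → ((a ⊗ b) ⊗ c) ≈ₛ (a ⊗ (b ⊗ c))
⊗-assoc a b c n = begin
  sumTo n (λ k → sumTo k (λ i → a i * b (k ∸ i)) * c (n ∸ k))
    ≡⟨ sumTo-ext n (λ k → *-distribʳ-sumTo k (c (n ∸ k)) _) ⟩
  sumTo n (λ k → sumTo k (λ i → a i * b (k ∸ i) * c (n ∸ k)))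
    ≡⟨ sumTo-triangle n (λ k i → a i * b (k ∸ i) * c (n ∸ k)) ⟩
  sumTo n (λ i → sumTo (n ∸ i) (λ j → a i * b (i ℕ.+ j ∸ i) * c (n ∸ (i ℕ.+ j))))
    ≡⟨ sumTo-ext n (λ i → sumTo-ext (n ∸ i) (λ j →
         trans (cong₂ (λ k l → a i * b k * c l) (ℕₚ.m+n∸m≡n i j) (sym (ℕₚ.∸-+-assoc n i j)))
               (ℤₚ.*-assoc (a i) (b j) (c (n ∸ i ∸ j))))) ⟩
  sumTo n (λ i → sumTo (n ∸ i) (λ j → a i * (b j * c (n ∸ i ∸ j))))
    ≡⟨ sumTo-ext n (λ i → sym (*-distribˡ-sumTo (n ∸ i) (a i) _)) ⟩
  sumTo n (λ i → a i * sumTo (n ∸ i) (λ j → b j * c (n ∸ i ∸ j))) ∎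
  where open ≡-Reasoning

⊗-identityˡ : ∀ a → (one ⊗ a) ≈ₛ a
⊗-identityˡ a n = trans (sumTo-single n 0 _ z≤n one-off) (ℤₚ.*-identityˡ (a n))
  where
  one-off : ∀ i → ¬ i ≡ 0 → one i * a (n ∸ i) ≡ + 0
  one-off zero    i≢0 = ⊥-elim (i≢0 refl)
  one-off (suc i) _   = refl

⊗-identityʳ : ∀ a → (a ⊗ one) ≈ₛ a
⊗-identityʳ a = ≈ₛ-trans (⊗-comm a one) (⊗-identityˡ a)

⊗-commutativeMonoid : CommutativeMonoid _ _
⊗-commutativeMonoid = record
  { Carrier               = Series
  ; _≈_                   = _≈ₛ_
  ; _∙_                   = _⊗_
  ; ε                     = one
  ; isCommutativeMonoid   = record
    { isMonoid = record
      { isSemigroup = record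
        { isMagma = record { isEquivalence = Setoid.isEquivalence ≈ₛ-setoid ; ∙-cong = ⊗-cong }
        ; assoc   = ⊗-assoc
        }
      ; identity = ⊗-identityˡ , ⊗-identityʳ
      }
    ; comm = ⊗-comm
    }
  }

open import Algebra.Solver.CommutativeMonoid ⊗-commutativeMonoid using (solve; _⊜_; _⊕_; id)

⊗-distribˡ-+ₛ : ∀ a b c → (a ⊗ (b +ₛ c)) ≈ₛ ((a ⊗ b) +ₛ (a ⊗ c))
⊗-distribˡ-+ₛ a b c n =
  trans (sumTo-ext n (λ i → ℤₚ.*-distribˡ-+ (a i) (b (n ∸ i)) (c (n ∸ i)))) (sumTo-+ n _ _)

⊗-scaleʳ : ∀ c a b → (a ⊗ scale c b) ≈ₛ scale c (a ⊗ b)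
⊗-scaleʳ c a b n = trans (sumTo-ext n (λ i → x*[c*y]≡c*[x*y] (a i) c (b (n ∸ i))))
                         (sym (*-distribˡ-sumTo n c _))
  where
  x*[c*y]≡c*[x*y] : ∀ x c y → x * (c * y) ≡ c * (x * y)
  x*[c*y]≡c*[x*y] = solve-∀

pow-cong : ∀ {a b} k → a ≈ₛ b → pow a k ≈ₛ pow b k
pow-cong zero    a≈b = ≈ₛ-refl
pow-cong (suc k) a≈b = ⊗-cong a≈b (pow-cong k a≈b)

pow-+ : ∀ a i j → pow a (i ℕ.+ j) ≈ₛ (pow a i ⊗ pow a j)
pow-+ a zero    j = ≈ₛ-sym (⊗-identityˡ (pow a j))
pow-+ a (suc i) j = ≈ₛ-trans (⊗-congʳ a (pow-+ a i j)) (≈ₛ-sym (⊗-assoc a (pow a i) (pow a j)))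

pow-⊗ : ∀ a b k → pow (a ⊗ b) k ≈ₛ (pow a k ⊗ pow b k)
pow-⊗ a b zero    = ≈ₛ-sym (⊗-identityˡ one)
pow-⊗ a b (suc k) = ≈ₛ-trans (⊗-congʳ (a ⊗ b) (pow-⊗ a b k))
  (solve 4 (λ a b c d → (a ⊕ b) ⊕ (c ⊕ d) ⊜ (a ⊕ c) ⊕ (b ⊕ d)) ≈ₛ-refl a b (pow a k) (pow b k))

X⊗-suc : ∀ a n → (X ⊗ a) (suc n) ≡ a n
X⊗-suc a n = trans (sumTo-single (suc n) 1 _ (s≤s z≤n) X-off) (ℤₚ.*-identityˡ (a n))
  where
  X-off : ∀ i → ¬ i ≡ 1 → X i * a (suc n ∸ i) ≡ + 0
  X-off zero          _   = refl
  X-off (suc zero)    i≢1 = ⊥-elim (i≢1 refl)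
  X-off (suc (suc i)) _   = refl

powX⊗-< : ∀ k w n → n < k → (pow X k ⊗ w) n ≡ + 0
powX⊗-< (suc k) w n n<k = trans (⊗-assoc X (pow X k) w n) (X⊗-< n n<k)
  where
  X⊗-< : ∀ n → n < suc k → (X ⊗ (pow X k ⊗ w)) n ≡ + 0
  X⊗-< zero    _         = refl
  X⊗-< (suc n) (s≤s n<k) = trans (X⊗-suc (pow X k ⊗ w) n) (powX⊗-< k w n n<k)

powX⊗-+ : ∀ k w n → (pow X k ⊗ w) (k ℕ.+ n) ≡ w n
powX⊗-+ zero    w n = ⊗-identityˡ w n
powX⊗-+ (suc k) w n = trans (⊗-assoc X (pow X k) w (suc (k ℕ.+ n)))
                            (trans (X⊗-suc (pow X k ⊗ w) (k ℕ.+ n)) (powX⊗-+ k w n))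

powX⊗-coeff : ∀ k e n w → k ℕ.+ e ≡ n → (pow X k ⊗ w) n ≡ w e
powX⊗-coeff k e _ w refl = powX⊗-+ k w e

powX⊗-shift : ∀ i k w n → (pow X (i ℕ.+ k) ⊗ w) (i ℕ.+ n) ≡ (pow X k ⊗ w) n
powX⊗-shift i k w n = begin
  (pow X (i ℕ.+ k) ⊗ w) (i ℕ.+ n)       ≡⟨ ⊗-congˡ w (pow-+ X i k) (i ℕ.+ n) ⟩
  ((pow X i ⊗ pow X k) ⊗ w) (i ℕ.+ n)   ≡⟨ ⊗-assoc (pow X i) (pow X k) w (i ℕ.+ n) ⟩
  (pow X i ⊗ (pow X k ⊗ w)) (i ℕ.+ n)   ≡⟨ powX⊗-+ i (pow X k ⊗ w) n ⟩
  (pow X k ⊗ w) n                       ∎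
  where open ≡-Reasoning

divX : Series → Series
divX u n = u (suc n)

X⊗divX : ∀ u → u 0 ≡ + 0 → u ≈ₛ (X ⊗ divX u)
X⊗divX u u0 zero    = u0
X⊗divX u u0 (suc n) = sym (X⊗-suc (divX u) n)

pow≈powX⊗pow-divX : ∀ u → u 0 ≡ + 0 → ∀ k → pow u k ≈ₛ (pow X k ⊗ pow (divX u) k)
pow≈powX⊗pow-divX u u0 k = ≈ₛ-trans (pow-cong k (X⊗divX u u0)) (pow-⊗ X (divX u) k)

pow-< : ∀ u → u 0 ≡ + 0 → ∀ k n → n < k → pow u k n ≡ + 0
pow-< u u0 k n n<k = trans (pow≈powX⊗pow-divX u u0 k n) (powX⊗-< k (pow (divX u) k) n n<k)

pow-const : ∀ v → v 0 ≡ + 1 → ∀ k → pow v k 0 ≡ + 1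
pow-const v v0 zero    = refl
pow-const v v0 (suc k) = cong₂ _*_ v0 (pow-const v v0 k)

pow-diag : ∀ u → u 0 ≡ + 0 → u 1 ≡ + 1 → ∀ n → pow u n n ≡ + 1
pow-diag u u0 u1 n = begin
  pow u n n                                   ≡⟨ pow≈powX⊗pow-divX u u0 n n ⟩
  (pow X n ⊗ pow (divX u) n) n                ≡⟨ powX⊗-coeff n 0 n (pow (divX u) n) (ℕₚ.+-identityʳ n) ⟩
  pow (divX u) n 0                            ≡⟨ pow-const (divX u) u1 n ⟩
  + 1                                         ∎
  where open ≡-Reasoning

-- Lower-triangular matrices

infixl 7 _·ᵥ_

_·ᵥ_ : Matrix → Series → Series
(P ·ᵥ v) n = sumTo n (λ j → P n j * v j)

UnitDiagonal : Matrix → Set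
UnitDiagonal P = ∀ n → P n n ≡ + 1

·ᵥ-assoc : ∀ P Q v → LowerTriangular Q → (P ·ᵥ (Q ·ᵥ v)) ≈ₛ ((P · Q) ·ᵥ v)
·ᵥ-assoc P Q v Q-lower n = begin
  sumTo n (λ j → P n j * sumTo j (λ l → Q j l * v l))
    ≡⟨ sumTo-cong n (λ j j≤n → cong (P n j *_) (sym (sumTo-extend _ j≤n (λ l j<l →
         trans (cong (_* v l) (Q-lower j l j<l)) refl)))) ⟩
  sumTo n (λ j → P n j * sumTo n (λ l → Q j l * v l))
    ≡⟨ sumTo-ext n (λ j → trans (*-distribˡ-sumTo n (P n j) _)
         (sumTo-ext n (λ l → sym (ℤₚ.*-assoc (P n j) (Q j l) (v l))))) ⟩
  sumTo n (λ j → sumTo n (λ l → P n j * Q j l * v l))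
    ≡⟨ sumTo-comm n n _ ⟩
  sumTo n (λ l → sumTo n (λ j → P n j * Q j l * v l))
    ≡⟨ sumTo-ext n (λ l → sym (*-distribʳ-sumTo n (v l) _)) ⟩
  sumTo n (λ l → (P · Q) n l * v l) ∎
  where open ≡-Reasoning

·-assoc : ∀ P Q S → LowerTriangular Q → ((P · Q) · S) ≈ₘ (P · (Q · S))
·-assoc P Q S Q-lower n k = sym (·ᵥ-assoc P Q (λ l → S l k) Q-lower n)

·-congʳ : ∀ P {Q S} → Q ≈ₘ S → (P · Q) ≈ₘ (P · S)
·-congʳ P Q≈S n k = sumTo-ext n (λ j → cong (P n j *_) (Q≈S j k))

·-congˡ : ∀ {P Q} S → P ≈ₘ Q → (P · S) ≈ₘ (Q · S)
·-congˡ S P≈Q n k = sumTo-ext n (λ j → cong (_* S j k) (P≈Q n j))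

Id-diag : UnitDiagonal Id
Id-diag n with n ℕ.≟ n
... | yes _   = refl
... | no  n≢n = ⊥-elim (n≢n refl)

Id-off : ∀ n k → ¬ n ≡ k → Id n k ≡ + 0
Id-off n k n≢k with n ℕ.≟ k
... | yes n≡k = ⊥-elim (n≢k n≡k)
... | no  _   = refl

·-identityˡ : ∀ P → (Id · P) ≈ₘ P
·-identityˡ P n k = begin
  sumTo n (λ j → Id n j * P j k)  ≡⟨ sumTo-single n n _ ℕₚ.≤-refl off-diag ⟩
  Id n n * P n k                  ≡⟨ cong (_* P n k) (Id-diag n) ⟩
  + 1 * P n k                     ≡⟨ ℤₚ.*-identityˡ (P n k) ⟩
  P n k                           ∎
  where
  open ≡-Reasoning
  off-diag : ∀ j → ¬ j ≡ n → Id n j * P j k ≡ + 0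
  off-diag j j≢n = cong (_* P j k) (Id-off n j (λ n≡j → j≢n (sym n≡j)))

·-identityʳ : ∀ P → LowerTriangular P → (P · Id) ≈ₘ P
·-identityʳ P P-lower n k = trans (sumTo-ext n (λ j → ℤₚ.*-comm (P n j) (Id j k))) column
  where
  off-diag : ∀ j → ¬ j ≡ k → Id j k * P n j ≡ + 0
  off-diag j j≢k = cong (_* P n j) (Id-off j k j≢k)
  column : sumTo n (λ j → Id j k * P n j) ≡ P n k
  column with k ℕ.≤? n
  ... | yes k≤n = trans (sumTo-single n k _ k≤n off-diag)
                        (trans (cong (_* P n k) (Id-diag k)) (ℤₚ.*-identityˡ (P n k)))
  ... | no  k≰n = trans (sumTo-zero n _ (λ j j≤n → off-diag j (λ { refl → k≰n j≤n })))
                        (sym (P-lower n k (ℕₚ.≰⇒> k≰n)))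

·ᵥ-cancelˡ : ∀ P {v w} → LowerTriangular P → UnitDiagonal P →
  (P ·ᵥ v) ≈ₛ (P ·ᵥ w) → v ≈ₛ w
·ᵥ-cancelˡ P {v} {w} P-lower P-diag Pv≈Pw n = agree-below n n ℕₚ.≤-refl
  where
  diag-term : ∀ (u : Series) n → P n n * u n ≡ u n
  diag-term u n = trans (cong (_* u n) (P-diag n)) (ℤₚ.*-identityˡ (u n))
  agree-below : ∀ m j → j ≤ m → v j ≡ w j
  agree-below zero    zero z≤n = trans (sym (diag-term v 0)) (trans (Pv≈Pw 0) (diag-term w 0))
  agree-below (suc m) j j≤m with j ℕ.≟ suc m
  ... | no  j≢m  = agree-below m j (ℕₚ.≤-pred (ℕₚ.≤∧≢⇒< j≤m j≢m))
  ... | yes refl = begin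
    v j             ≡⟨ sym (diag-term v j) ⟩
    P j j * v j     ≡⟨ +-cancelˡ (earlier w) (P j j * v j) (P j j * w j) rows-agree ⟩
    P j j * w j     ≡⟨ diag-term w j ⟩
    w j             ∎
    where
    open ≡-Reasoning
    earlier : Series → ℤ
    earlier u = sumTo m (λ i → P j i * u i)
    rows-agree : earlier w + P j j * v j ≡ earlier w + P j j * w j
    rows-agree = trans
      (cong (_+ P j j * v j) (sumTo-cong m (λ i i≤m → cong (P j i *_) (sym (agree-below m i i≤m)))))
      (Pv≈Pw j)

inverseˡ⇒inverseʳ : ∀ R L → LowerTriangular R → UnitDiagonal R → LowerTriangular L →
  (R · L) ≈ₘ Id → (L · R) ≈ₘ Id
inverseˡ⇒inverseʳ R L R-lower R-diag L-lower RL≈Id n m =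
  ·ᵥ-cancelˡ R R-lower R-diag R·[LR]≈R·Id n
  where
  R·[LR]≈R·Id : (R ·ᵥ (λ i → (L · R) i m)) ≈ₛ (R ·ᵥ (λ i → Id i m))
  R·[LR]≈R·Id i = begin
    (R · (L · R)) i m  ≡⟨ sym (·-assoc R L R L-lower i m) ⟩
    ((R · L) · R) i m  ≡⟨ ·-congˡ R RL≈Id i m ⟩
    (Id · R) i m       ≡⟨ ·-identityˡ R i m ⟩
    R i m              ≡⟨ sym (·-identityʳ R R-lower i m) ⟩
    (R · Id) i m       ∎
    where open ≡-Reasoning

inverse-unique : ∀ M N C A → LowerTriangular M → (N · M) ≈ₘ Id → (M · C) ≈ₘ A → C ≈ₘ (N · A)
inverse-unique M N C A M-lower NM≈Id MC≈A n k = sym (begin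
  (N · A) n k        ≡⟨ ·-congʳ N (λ i j → sym (MC≈A i j)) n k ⟩
  (N · (M · C)) n k  ≡⟨ sym (·-assoc N M C M-lower n k) ⟩
  ((N · M) · C) n k  ≡⟨ ·-congˡ C NM≈Id n k ⟩
  (Id · C) n k       ≡⟨ ·-identityˡ C n k ⟩
  C n k              ∎)
  where open ≡-Reasoning

Riordan-lower : ∀ d u → u 0 ≡ + 0 → LowerTriangular (Riordan d u)
Riordan-lower d u u0 n k n<k = sumTo-zero n _ (λ i _ →
  trans (cong (d i *_) (pow-< u u0 k (n ∸ i) (ℕₚ.≤-<-trans (ℕₚ.m∸n≤m n i) n<k))) (ℤₚ.*-zeroʳ (d i)))

compose-upTo : ∀ a u → u 0 ≡ + 0 → ∀ {n m} → n ≤ m →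
  sumTo m (λ k → a k * pow u k n) ≡ compose a u n
compose-upTo a u u0 {n} n≤m = sumTo-extend _ n≤m (λ k n<k →
  trans (cong (a k *_) (pow-< u u0 k n n<k)) (ℤₚ.*-zeroʳ (a k)))

Riordan-·ᵥ : ∀ d u a → u 0 ≡ + 0 → (Riordan d u ·ᵥ a) ≈ₛ (d ⊗ compose a u)
Riordan-·ᵥ d u a u0 n = begin
  sumTo n (λ j → sumTo n (λ i → d i * pow u j (n ∸ i)) * a j)
    ≡⟨ sumTo-ext n (λ j → *-distribʳ-sumTo n (a j) _) ⟩
  sumTo n (λ j → sumTo n (λ i → d i * pow u j (n ∸ i) * a j))
    ≡⟨ sumTo-comm n n _ ⟩
  sumTo n (λ i → sumTo n (λ j → d i * pow u j (n ∸ i) * a j))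
    ≡⟨ sumTo-ext n (λ i → trans (sumTo-ext n (λ j → x*y*z≡x*[z*y] (d i) _ (a j)))
                                (sym (*-distribˡ-sumTo n (d i) _))) ⟩
  sumTo n (λ i → d i * sumTo n (λ j → a j * pow u j (n ∸ i)))
    ≡⟨ sumTo-ext n (λ i → cong (d i *_) (compose-upTo a u u0 (ℕₚ.m∸n≤m n i))) ⟩
  sumTo n (λ i → d i * compose a u (n ∸ i)) ∎
  where
  open ≡-Reasoning
  x*y*z≡x*[z*y] : ∀ x y z → x * y * z ≡ x * (z * y)
  x*y*z≡x*[z*y] = solve-∀

compose-congˡ : ∀ {a a′} u → a ≈ₛ a′ → compose a u ≈ₛ compose a′ u
compose-congˡ u a≈a′ n = sumTo-ext n (λ k → cong (_* pow u k n) (a≈a′ k))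

compose-congʳ : ∀ a {u u′} → u ≈ₛ u′ → compose a u ≈ₛ compose a u′
compose-congʳ a u≈u′ n = sumTo-ext n (λ k → cong (a k *_) (pow-cong k u≈u′ n))

Id-suc : ∀ m k → Id (suc m) (suc k) ≡ Id m k
Id-suc m k = by-cases (m ℕ.≟ k)
  where
  by-cases : Dec (m ≡ k) → Id (suc m) (suc k) ≡ Id m k
  by-cases (yes refl) = trans (Id-diag (suc m)) (sym (Id-diag m))
  by-cases (no  m≢k)  = trans (Id-off (suc m) (suc k) (λ sm≡sk → m≢k (ℕₚ.suc-injective sm≡sk)))
                              (sym (Id-off m k m≢k))

pow-X≡Id : ∀ k n → pow X k n ≡ Id n k
pow-X≡Id zero    zero    = refl
pow-X≡Id zero    (suc n) = refl
pow-X≡Id (suc k) zero    = refl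
pow-X≡Id (suc k) (suc n) = trans (X⊗-suc (pow X k) n) (trans (pow-X≡Id k n) (sym (Id-suc n k)))

compose-X : ∀ a → compose a X ≈ₛ a
compose-X a n = trans (sumTo-ext n (λ k → trans (cong (a k *_) (pow-X≡Id k n)) (ℤₚ.*-comm (a k) (Id n k))))
                      (·-identityˡ (λ j _ → a j) n 0)

X-compose : ∀ u → u 0 ≡ + 0 → compose X u ≈ₛ u
X-compose u u0 zero    = sym u0
X-compose u u0 (suc n) = trans (sumTo-single (suc n) 1 _ (s≤s z≤n) X-off)
                               (trans (ℤₚ.*-identityˡ _) (⊗-identityʳ u (suc n)))
  where
  X-off : ∀ k → ¬ k ≡ 1 → X k * pow u k (suc n) ≡ + 0
  X-off zero          _   = refl
  X-off (suc zero)    k≢1 = ⊥-elim (k≢1 refl)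
  X-off (suc (suc k)) _   = refl

one-compose : ∀ u → compose one u ≈ₛ one
one-compose u n = trans (sumTo-single n 0 _ z≤n one-off) (ℤₚ.*-identityˡ (one n))
  where
  one-off : ∀ k → ¬ k ≡ 0 → one k * pow u k n ≡ + 0
  one-off zero    k≢0 = ⊥-elim (k≢0 refl)
  one-off (suc k) _   = refl

compose-⊗ : ∀ a b u → u 0 ≡ + 0 → compose (a ⊗ b) u ≈ₛ (compose a u ⊗ compose b u)
compose-⊗ a b u u0 n = begin
  sumTo n (λ k → sumTo k (λ i → a i * b (k ∸ i)) * pow u k n)
    ≡⟨ sumTo-ext n (λ k → *-distribʳ-sumTo k _ _) ⟩
  sumTo n (λ k → sumTo k (λ i → a i * b (k ∸ i) * pow u k n))
    ≡⟨ sumTo-triangle n _ ⟩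
  sumTo n (λ i → sumTo (n ∸ i) (λ j → a i * b (i ℕ.+ j ∸ i) * pow u (i ℕ.+ j) n))
    ≡⟨ sumTo-ext n (λ i → sumTo-ext (n ∸ i) (λ j →
         cong (λ l → a i * b l * pow u (i ℕ.+ j) n) (ℕₚ.m+n∸m≡n i j))) ⟩
  sumTo n (λ i → sumTo (n ∸ i) (λ j → a i * b j * pow u (i ℕ.+ j) n))
    ≡⟨ sumTo-ext n (λ i → sym (sumTo-extend _ (ℕₚ.m∸n≤m n i) (λ j n∸i<j →
         trans (cong (a i * b j *_) (pow-< u u0 (i ℕ.+ j) n (∸<⇒< n∸i<j)))
               (ℤₚ.*-zeroʳ (a i * b j))))) ⟩
  sumTo n (λ i → sumTo n (λ j → a i * b j * pow u (i ℕ.+ j) n))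
    ≡⟨ sumTo-ext n (λ i → sumTo-ext n (λ j → trans (cong (a i * b j *_) (pow-+ u i j n))
         (trans (*-distribˡ-sumTo n (a i * b j) _)
                (sumTo-ext n (λ p → regroup (a i) (b j) (pow u i p) (pow u j (n ∸ p))))))) ⟩
  sumTo n (λ i → sumTo n (λ j → sumTo n (λ p → (a i * pow u i p) * (b j * pow u j (n ∸ p)))))
    ≡⟨ trans (sumTo-ext n (λ i → sumTo-comm n n _)) (sumTo-comm n n _) ⟩
  sumTo n (λ p → sumTo n (λ i → sumTo n (λ j → (a i * pow u i p) * (b j * pow u j (n ∸ p)))))
    ≡⟨ sumTo-ext n (λ p → sym (sumTo-*-sumTo n n _ _)) ⟩
  sumTo n (λ p → sumTo n (λ i → a i * pow u i p) * sumTo n (λ j → b j * pow u j (n ∸ p)))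
    ≡⟨ sumTo-cong n (λ p p≤n → cong₂ _*_ (compose-upTo a u u0 p≤n)
                                         (compose-upTo b u u0 (ℕₚ.m∸n≤m n p))) ⟩
  sumTo n (λ p → compose a u p * compose b u (n ∸ p)) ∎
  where
  open ≡-Reasoning
  regroup : ∀ x y s t → x * y * (s * t) ≡ (x * s) * (y * t)
  regroup = solve-∀
  ∸<⇒< : ∀ {i j} → n ∸ i < j → n < i ℕ.+ j
  ∸<⇒< {i} n∸i<j = ℕₚ.≤-<-trans (ℕₚ.m≤n+m∸n n i) (ℕₚ.+-monoʳ-< i n∸i<j)

pow-compose : ∀ v u → u 0 ≡ + 0 → ∀ k → compose (pow v k) u ≈ₛ pow (compose v u) k
pow-compose v u u0 zero    = one-compose u
pow-compose v u u0 (suc k) =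
  ≈ₛ-trans (compose-⊗ v (pow v k) u u0) (⊗-congʳ (compose v u) (pow-compose v u u0 k))

powerMatrix : Series → Matrix
powerMatrix u n k = pow u k n

compose≈powerMatrix·ᵥ : ∀ a u → compose a u ≈ₛ (powerMatrix u ·ᵥ a)
compose≈powerMatrix·ᵥ a u n = sumTo-ext n (λ k → ℤₚ.*-comm (a k) (pow u k n))

compose-assoc : ∀ a v u → u 0 ≡ + 0 → v 0 ≡ + 0 →
  compose (compose a v) u ≈ₛ compose a (compose v u)
compose-assoc a v u u0 v0 n = begin
  compose (compose a v) u n
    ≡⟨ compose≈powerMatrix·ᵥ (compose a v) u n ⟩
  (powerMatrix u ·ᵥ compose a v) n
    ≡⟨ sumTo-ext n (λ j → cong (pow u j n *_) (compose≈powerMatrix·ᵥ a v j)) ⟩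
  (powerMatrix u ·ᵥ (powerMatrix v ·ᵥ a)) n
    ≡⟨ ·ᵥ-assoc (powerMatrix u) (powerMatrix v) a (λ j k → pow-< v v0 k j) n ⟩
  ((powerMatrix u · powerMatrix v) ·ᵥ a) n
    ≡⟨ sumTo-ext n (λ k → trans (ℤₚ.*-comm _ (a k)) (cong (a k *_) (trans
         (sumTo-ext n (λ j → ℤₚ.*-comm (pow u j n) (pow v k j))) (pow-compose v u u0 k n)))) ⟩
  compose a (compose v u) n ∎
  where open ≡-Reasoning

deriv-cong : ∀ {a b} → a ≈ₛ b → deriv a ≈ₛ deriv b
deriv-cong a≈b n = cong (+ suc n *_) (a≈b (suc n))

deriv-X : deriv X ≈ₛ one
deriv-X zero    = refl
deriv-X (suc n) = ℤₚ.*-zeroʳ (+ suc (suc n))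

deriv-one : ∀ n → deriv one n ≡ + 0
deriv-one n = ℤₚ.*-zeroʳ (+ suc n)

deriv-⊗ : ∀ a b → deriv (a ⊗ b) ≈ₛ ((deriv a ⊗ b) +ₛ (a ⊗ deriv b))
deriv-⊗ a b n = begin
  + suc n * sumTo (suc n) (λ i → a i * b (suc n ∸ i))
    ≡⟨ *-distribˡ-sumTo (suc n) (+ suc n) _ ⟩
  sumTo (suc n) (λ i → + suc n * (a i * b (suc n ∸ i)))
    ≡⟨ sumTo-cong (suc n) (λ i i≤n → trans
         (cong (λ m → + m * (a i * b (suc n ∸ i))) (sym (ℕₚ.m+[n∸m]≡n i≤n)))
         (trans (cong (_* (a i * b (suc n ∸ i))) (ℤₚ.pos-+ i (suc n ∸ i)))
                (split (+ i) (+ (suc n ∸ i)) (a i) (b (suc n ∸ i))))) ⟩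
  sumTo (suc n) (λ i → + i * a i * b (suc n ∸ i) + a i * (+ (suc n ∸ i) * b (suc n ∸ i)))
    ≡⟨ sumTo-+ (suc n) _ _ ⟩
  sumTo (suc n) (λ i → + i * a i * b (suc n ∸ i)) + sumTo (suc n) (λ i → a i * (+ (suc n ∸ i) * b (suc n ∸ i)))
    ≡⟨ cong₂ _+_ (trans (sumTo-suc-head n (λ i → + i * a i * b (suc n ∸ i)))
                        (ℤₚ.+-identityˡ (sumTo n (λ i → + suc i * a (suc i) * b (n ∸ i)))))
                 last-term-vanishes ⟩
  sumTo n (λ i → + suc i * a (suc i) * b (n ∸ i)) + sumTo n (λ i → a i * (+ (suc n ∸ i) * b (suc n ∸ i)))
    ≡⟨ cong (_+_ (sumTo n (λ i → + suc i * a (suc i) * b (n ∸ i))))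
         (sumTo-cong n (λ i i≤n → cong (λ m → a i * (+ m * b m)) (ℕₚ.+-∸-assoc 1 i≤n))) ⟩
  sumTo n (λ i → + suc i * a (suc i) * b (n ∸ i)) + sumTo n (λ i → a i * (+ suc (n ∸ i) * b (suc (n ∸ i)))) ∎
  where
  open ≡-Reasoning
  split : ∀ x y s t → (x + y) * (s * t) ≡ x * s * t + s * (y * t)
  split = solve-∀
  last-term-vanishes : sumTo (suc n) (λ i → a i * (+ (suc n ∸ i) * b (suc n ∸ i)))
                     ≡ sumTo n (λ i → a i * (+ (suc n ∸ i) * b (suc n ∸ i)))
  last-term-vanishes = trans
    (cong (_+_ (sumTo n (λ i → a i * (+ (suc n ∸ i) * b (suc n ∸ i)))))
          (trans (cong (λ m → a (suc n) * (+ m * b m)) (ℕₚ.n∸n≡0 n)) (ℤₚ.*-zeroʳ (a (suc n)))))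
    (ℤₚ.+-identityʳ _)

deriv-pow : ∀ u k → deriv (pow u (suc k)) ≈ₛ scale (+ suc k) (deriv u ⊗ pow u k)
deriv-pow u zero    n = trans (deriv-cong (⊗-identityʳ u) n)
                              (sym (trans (ℤₚ.*-identityˡ _) (⊗-identityʳ (deriv u) n)))
deriv-pow u (suc k) n = begin
  deriv (u ⊗ pow u (suc k)) n
    ≡⟨ deriv-⊗ u (pow u (suc k)) n ⟩
  (deriv u ⊗ pow u (suc k)) n + (u ⊗ deriv (pow u (suc k))) n
    ≡⟨ cong (_+_ ((deriv u ⊗ pow u (suc k)) n)) (begin
         (u ⊗ deriv (pow u (suc k))) n                   ≡⟨ ⊗-congʳ u (deriv-pow u k) n ⟩
         (u ⊗ scale (+ suc k) (deriv u ⊗ pow u k)) n     ≡⟨ ⊗-scaleʳ (+ suc k) u (deriv u ⊗ pow u k) n ⟩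
         + suc k * (u ⊗ (deriv u ⊗ pow u k)) n           ≡⟨ cong (+ suc k *_) (x∙yz≈y∙xz u (deriv u) (pow u k) n) ⟩
         + suc k * (deriv u ⊗ pow u (suc k)) n           ∎) ⟩
  (deriv u ⊗ pow u (suc k)) n + + suc k * (deriv u ⊗ pow u (suc k)) n
    ≡⟨ x+cx≡[1+c]x (+ suc k) _ ⟩
  + suc (suc k) * (deriv u ⊗ pow u (suc k)) n ∎
  where
  open ≡-Reasoning
  x∙yz≈y∙xz : ∀ x y z → (x ⊗ (y ⊗ z)) ≈ₛ (y ⊗ (x ⊗ z))
  x∙yz≈y∙xz = solve 3 (λ x y z → x ⊕ (y ⊕ z) ⊜ y ⊕ (x ⊕ z)) ≈ₛ-refl
  x+cx≡[1+c]x : ∀ c x → x + c * x ≡ (+ 1 + c) * x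
  x+cx≡[1+c]x = solve-∀

pow-diag-suc : ∀ f s → (pow f s ⊗ deriv f) s ≡ pow f (suc s) (suc s)
pow-diag-suc f s = sym (ℤₚ.*-cancelˡ-≡ (+ suc s) _ _ (trans (deriv-pow f s s)
  (cong (+ suc s *_) (⊗-comm (deriv f) (pow f s) s))))

deriv-compose : ∀ a u → u 0 ≡ + 0 → deriv (compose a u) ≈ₛ (deriv u ⊗ compose (deriv a) u)
deriv-compose a u u0 n = begin
  + suc n * sumTo (suc n) (λ k → a k * pow u k (suc n))
    ≡⟨ *-distribˡ-sumTo (suc n) (+ suc n) _ ⟩
  sumTo (suc n) (λ k → + suc n * (a k * pow u k (suc n)))
    ≡⟨ sumTo-ext (suc n) (λ k → c*[x*y]≡x*[c*y] (+ suc n) (a k) (pow u k (suc n))) ⟩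
  sumTo (suc n) (λ k → a k * deriv (pow u k) n)
    ≡⟨ sumTo-suc-head n _ ⟩
  a 0 * deriv one n + sumTo n (λ k → a (suc k) * deriv (pow u (suc k)) n)
    ≡⟨ cong₂ _+_ (trans (cong (a 0 *_) (deriv-one n)) (ℤₚ.*-zeroʳ (a 0)))
         (sumTo-ext n (λ k → trans (cong (a (suc k) *_) (deriv-pow u k n))
                                   (x*[c*y]≡y*[c*x] (a (suc k)) (+ suc k) _))) ⟩
  + 0 + (Riordan (deriv u) u ·ᵥ deriv a) n
    ≡⟨ ℤₚ.+-identityˡ _ ⟩
  (Riordan (deriv u) u ·ᵥ deriv a) n
    ≡⟨ Riordan-·ᵥ (deriv u) u (deriv a) u0 n ⟩
  (deriv u ⊗ compose (deriv a) u) n ∎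
  where
  open ≡-Reasoning
  c*[x*y]≡x*[c*y] : ∀ c x y → c * (x * y) ≡ x * (c * y)
  c*[x*y]≡x*[c*y] = solve-∀
  x*[c*y]≡y*[c*x] : ∀ x c y → x * (c * y) ≡ y * (c * x)
  x*[c*y]≡y*[c*x] = solve-∀

reversion-coeff-1 : ∀ h φ → h 1 ≡ + 1 → compose h φ ≈ₛ X → φ 1 ≡ + 1
reversion-coeff-1 h φ h1 h∘φ≈X = begin
  φ 1                                   ≡⟨ sym (⊗-identityʳ φ 1) ⟩
  pow φ 1 1                             ≡⟨ sym (ℤₚ.*-identityˡ (pow φ 1 1)) ⟩
  + 1 * pow φ 1 1                       ≡⟨ cong (_* pow φ 1 1) (sym h1) ⟩
  h 1 * pow φ 1 1                       ≡⟨ sym (ℤₚ.+-identityˡ (h 1 * pow φ 1 1)) ⟩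
  + 0 + h 1 * pow φ 1 1                 ≡⟨ cong (_+ h 1 * pow φ 1 1) (sym (ℤₚ.*-zeroʳ (h 0))) ⟩
  compose h φ 1                         ≡⟨ h∘φ≈X 1 ⟩
  + 1                                   ∎
  where open ≡-Reasoning

reversion-inverseʳ : ∀ h φ → h 0 ≡ + 0 → h 1 ≡ + 1 → φ 0 ≡ + 0 →
  compose h φ ≈ₛ X → compose φ h ≈ₛ X
reversion-inverseʳ h φ h0 h1 φ0 h∘φ≈X =
  ·ᵥ-cancelˡ (powerMatrix φ) (λ n k → pow-< φ φ0 k n) (pow-diag φ φ0 (reversion-coeff-1 h φ h1 h∘φ≈X)) (begin
    powerMatrix φ ·ᵥ compose φ h     ≈⟨ ≈ₛ-sym (compose≈powerMatrix·ᵥ (compose φ h) φ) ⟩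
    compose (compose φ h) φ          ≈⟨ compose-assoc φ h φ φ0 h0 ⟩
    compose φ (compose h φ)          ≈⟨ compose-congʳ φ h∘φ≈X ⟩
    compose φ X                      ≈⟨ compose-X φ ⟩
    φ                                ≈⟨ ≈ₛ-sym (X-compose φ φ0) ⟩
    compose X φ                      ≈⟨ compose≈powerMatrix·ᵥ X φ ⟩
    powerMatrix φ ·ᵥ X               ∎)
  where open ≈ₛ-Reasoning

deriv-reversion : ∀ h φ → h 0 ≡ + 0 → h 1 ≡ + 1 → φ 0 ≡ + 0 →
  compose h φ ≈ₛ X → (compose (deriv φ) h ⊗ deriv h) ≈ₛ one
deriv-reversion h φ h0 h1 φ0 h∘φ≈X = begin
  compose (deriv φ) h ⊗ deriv h
    ≈⟨ ⊗-congʳ (compose (deriv φ) h) (≈ₛ-sym (≈ₛ-trans (compose-congʳ (deriv h) φ∘h≈X) (compose-X (deriv h)))) ⟩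
  compose (deriv φ) h ⊗ compose (deriv h) (compose φ h)
    ≈⟨ ⊗-congʳ (compose (deriv φ) h) (≈ₛ-sym (compose-assoc (deriv h) φ h h0 φ0)) ⟩
  compose (deriv φ) h ⊗ compose (compose (deriv h) φ) h
    ≈⟨ ≈ₛ-sym (compose-⊗ (deriv φ) (compose (deriv h) φ) h h0) ⟩
  compose (deriv φ ⊗ compose (deriv h) φ) h
    ≈⟨ compose-congˡ h (≈ₛ-sym (deriv-compose h φ φ0)) ⟩
  compose (deriv (compose h φ)) h
    ≈⟨ compose-congˡ h (≈ₛ-trans (deriv-cong h∘φ≈X) deriv-X) ⟩
  compose one h
    ≈⟨ one-compose h ⟩
  one ∎
  where
  open ≈ₛ-Reasoning
  φ∘h≈X : compose φ h ≈ₛ X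
  φ∘h≈X = reversion-inverseʳ h φ h0 h1 φ0 h∘φ≈X

-- Lagrange inversion

lagrangeMatrix : Series → Matrix
lagrangeMatrix f n m = (pow f (suc n) ⊗ pow X m) n

lagrangeMatrix-·ᵥ : ∀ f Q n → (lagrangeMatrix f ·ᵥ Q) n ≡ (pow f (suc n) ⊗ Q) n
lagrangeMatrix-·ᵥ f Q n = trans (Riordan-·ᵥ (pow f (suc n)) X Q refl n)
                                (⊗-congʳ (pow f (suc n)) (compose-X Q) n)

lagrangeMatrix-lower : ∀ f → LowerTriangular (lagrangeMatrix f)
lagrangeMatrix-lower f n = Riordan-lower (pow f (suc n)) X refl n

lagrangeMatrix-diag : ∀ f → f 0 ≡ + 1 → UnitDiagonal (lagrangeMatrix f)
lagrangeMatrix-diag f f0 n = begin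
  (pow f (suc n) ⊗ pow X n) n   ≡⟨ ⊗-comm (pow f (suc n)) (pow X n) n ⟩
  (pow X n ⊗ pow f (suc n)) n   ≡⟨ powX⊗-coeff n 0 n (pow f (suc n)) (ℕₚ.+-identityʳ n) ⟩
  pow f (suc n) 0               ≡⟨ pow-const f f0 (suc n) ⟩
  + 1                           ∎
  where open ≡-Reasoning

module Lagrange (f h : Series) (f0 : f 0 ≡ + 1) (h⊗f≈X : (h ⊗ f) ≈ₛ X) where

  h0 : h 0 ≡ + 0
  h0 = trans (sym (ℤₚ.*-identityʳ (h 0))) (trans (cong (h 0 *_) (sym f0)) (h⊗f≈X 0))

  deriv-h⊗f : ((deriv h ⊗ f) +ₛ (h ⊗ deriv f)) ≈ₛ one
  deriv-h⊗f = ≈ₛ-trans (≈ₛ-sym (deriv-⊗ h f)) (≈ₛ-trans (deriv-cong h⊗f≈X) deriv-X)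

  pow-f⊗pow-h : ∀ j e n → j ℕ.+ e ≡ n → (pow f n ⊗ pow h j) ≈ₛ (pow X j ⊗ pow f e)
  pow-f⊗pow-h j e _ refl = begin
    pow f (j ℕ.+ e) ⊗ pow h j
      ≈⟨ ⊗-congˡ (pow h j) (pow-+ f j e) ⟩
    (pow f j ⊗ pow f e) ⊗ pow h j
      ≈⟨ solve 3 (λ a b c → (a ⊕ b) ⊕ c ⊜ (c ⊕ a) ⊕ b) ≈ₛ-refl (pow f j) (pow f e) (pow h j) ⟩
    (pow h j ⊗ pow f j) ⊗ pow f e
      ≈⟨ ⊗-congˡ (pow f e) (≈ₛ-trans (≈ₛ-sym (pow-⊗ h f j)) (pow-cong j h⊗f≈X)) ⟩
    pow X j ⊗ pow f e
      ∎
    where open ≈ₛ-Reasoning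

  -- entry n j is the (n, j) entry of lagrangeMatrix f · Riordan (deriv h) h; adding correction n j
  -- gives [xⁿ] fⁿ hʲ because h′ f + h f′ = (h f)′ = 1.
  entry correction : ℕ → ℕ → ℤ
  entry n j = (pow f (suc n) ⊗ (deriv h ⊗ pow h j)) n
  correction n j = (pow f n ⊗ (pow h (suc j) ⊗ deriv f)) n

  entry+correction≡ : ∀ n j → entry n j + correction n j ≡ (pow f n ⊗ pow h j) n
  entry+correction≡ n j = series-identity n
    where
    open ≈ₛ-Reasoning
    fⁿhʲ : Series
    fⁿhʲ = pow f n ⊗ pow h j
    series-identity : ((pow f (suc n) ⊗ (deriv h ⊗ pow h j)) +ₛ (pow f n ⊗ (pow h (suc j) ⊗ deriv f)))
                      ≈ₛ fⁿhʲ
    series-identity = begin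
      (pow f (suc n) ⊗ (deriv h ⊗ pow h j)) +ₛ (pow f n ⊗ (pow h (suc j) ⊗ deriv f))
        ≈⟨ (λ i → cong₂ _+_
             (solve 4 (λ a b c d → (a ⊕ b) ⊕ (c ⊕ d) ⊜ (b ⊕ d) ⊕ (c ⊕ a)) ≈ₛ-refl
                      f (pow f n) (deriv h) (pow h j) i)
             (solve 4 (λ a b c d → a ⊕ ((b ⊕ c) ⊕ d) ⊜ (a ⊕ c) ⊕ (b ⊕ d)) ≈ₛ-refl
                      (pow f n) h (pow h j) (deriv f) i)) ⟩
      (fⁿhʲ ⊗ (deriv h ⊗ f)) +ₛ (fⁿhʲ ⊗ (h ⊗ deriv f))
        ≈⟨ ≈ₛ-sym (⊗-distribˡ-+ₛ fⁿhʲ (deriv h ⊗ f) (h ⊗ deriv f)) ⟩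
      fⁿhʲ ⊗ ((deriv h ⊗ f) +ₛ (h ⊗ deriv f))
        ≈⟨ ⊗-congʳ fⁿhʲ deriv-h⊗f ⟩
      fⁿhʲ ⊗ one
        ≈⟨ ⊗-identityʳ fⁿhʲ ⟩
      fⁿhʲ ∎

  entry+correction≡diag : ∀ j e n → j ℕ.+ e ≡ n → entry n j + correction n j ≡ pow f e e
  entry+correction≡diag j e n j+e≡n = trans (entry+correction≡ n j)
    (trans (pow-f⊗pow-h j e n j+e≡n n) (powX⊗-coeff j e n (pow f e) j+e≡n))

  correction-diag : ∀ j n → j ℕ.+ 0 ≡ n → correction n j ≡ + 0
  correction-diag j n j+0≡n = trans (⊗-assoc-swap (pow f n) (pow h (suc j)) (deriv f) n)
    (Riordan-lower (pow f n ⊗ deriv f) h h0 n (suc j)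
      (s≤s (ℕₚ.≤-reflexive (trans (sym j+0≡n) (ℕₚ.+-identityʳ j)))))
    where
    ⊗-assoc-swap : ∀ a b c → (a ⊗ (b ⊗ c)) ≈ₛ ((a ⊗ c) ⊗ b)
    ⊗-assoc-swap = solve 3 (λ a b c → a ⊕ (b ⊕ c) ⊜ (a ⊕ c) ⊕ b) ≈ₛ-refl

  correction-below : ∀ j s n → j ℕ.+ suc s ≡ n → correction n j ≡ pow f (suc s) (suc s)
  correction-below j s n j+1+s≡n = begin
    (pow f n ⊗ (pow h (suc j) ⊗ deriv f)) n      ≡⟨ sym (⊗-assoc (pow f n) (pow h (suc j)) (deriv f) n) ⟩
    ((pow f n ⊗ pow h (suc j)) ⊗ deriv f) n      ≡⟨ ⊗-congˡ (deriv f) (pow-f⊗pow-h (suc j) s n 1+j+s≡n) n ⟩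
    ((pow X (suc j) ⊗ pow f s) ⊗ deriv f) n      ≡⟨ ⊗-assoc (pow X (suc j)) (pow f s) (deriv f) n ⟩
    (pow X (suc j) ⊗ (pow f s ⊗ deriv f)) n      ≡⟨ powX⊗-coeff (suc j) s n (pow f s ⊗ deriv f) 1+j+s≡n ⟩
    (pow f s ⊗ deriv f) s                        ≡⟨ pow-diag-suc f s ⟩
    pow f (suc s) (suc s)                        ∎
    where
    open ≡-Reasoning
    1+j+s≡n : suc j ℕ.+ s ≡ n
    1+j+s≡n = trans (sym (ℕₚ.+-suc j s)) j+1+s≡n

  entry-above : ∀ n j → n < j → entry n j ≡ + 0
  entry-above n j n<j = trans (sym (⊗-assoc (pow f (suc n)) (deriv h) (pow h j) n))
                          (Riordan-lower (pow f (suc n) ⊗ deriv h) h h0 n j n<j)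

  entry≡Id-+ : ∀ j e n → j ℕ.+ e ≡ n → entry n j ≡ Id n j
  entry≡Id-+ j zero n j+0≡n = begin
    entry n j                   ≡⟨ sym (ℤₚ.+-identityʳ (entry n j)) ⟩
    entry n j + + 0             ≡⟨ cong (_+_ (entry n j)) (sym (correction-diag j n j+0≡n)) ⟩
    entry n j + correction n j  ≡⟨ entry+correction≡diag j 0 n j+0≡n ⟩
    + 1                         ≡⟨ sym (Id-diag j) ⟩
    Id j j                      ≡⟨ cong (λ m → Id m j) (trans (sym (ℕₚ.+-identityʳ j)) j+0≡n) ⟩
    Id n j                      ∎
    where open ≡-Reasoning
  entry≡Id-+ j (suc s) n j+1+s≡n = trans
    (+-cancelʳ (correction n j) (entry n j) (+ 0)
      (trans (entry+correction≡diag j (suc s) n j+1+s≡n)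
        (trans (sym (correction-below j s n j+1+s≡n)) (sym (ℤₚ.+-identityˡ (correction n j))))))
    (sym (Id-off n j (λ n≡j → ℕₚ.m+1+n≢m j (trans j+1+s≡n n≡j))))

  entry≡Id : ∀ n j → entry n j ≡ Id n j
  entry≡Id n j with j ℕ.≤? n
  ... | yes j≤n = entry≡Id-+ j (n ∸ j) n (ℕₚ.m+[n∸m]≡n j≤n)
  ... | no  j≰n = trans (entry-above n j (ℕₚ.≰⇒> j≰n))
                        (sym (Id-off n j (λ { refl → j≰n ℕₚ.≤-refl })))

  lagrangeMatrix·Riordan≈Id : (lagrangeMatrix f · Riordan (deriv h) h) ≈ₘ Id
  lagrangeMatrix·Riordan≈Id n j =
    trans (lagrangeMatrix-·ᵥ f (λ m → Riordan (deriv h) h m j) n) (entry≡Id n j)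

  Riordan·lagrangeMatrix≈Id : (Riordan (deriv h) h · lagrangeMatrix f) ≈ₘ Id
  Riordan·lagrangeMatrix≈Id = inverseˡ⇒inverseʳ (lagrangeMatrix f) (Riordan (deriv h) h)
    (lagrangeMatrix-lower f) (lagrangeMatrix-diag f f0) (Riordan-lower (deriv h) h h0)
    lagrangeMatrix·Riordan≈Id

  lagrange-inversion : ∀ Q → (deriv h ⊗ compose (lagrangeMatrix f ·ᵥ Q) h) ≈ₛ Q
  lagrange-inversion Q = begin
    deriv h ⊗ compose (lagrangeMatrix f ·ᵥ Q) h
      ≈⟨ ≈ₛ-sym (Riordan-·ᵥ (deriv h) h (lagrangeMatrix f ·ᵥ Q) h0) ⟩
    Riordan (deriv h) h ·ᵥ (lagrangeMatrix f ·ᵥ Q)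
      ≈⟨ ·ᵥ-assoc (Riordan (deriv h) h) (lagrangeMatrix f) Q (lagrangeMatrix-lower f) ⟩
    (Riordan (deriv h) h · lagrangeMatrix f) ·ᵥ Q
      ≈⟨ (λ n → sumTo-ext n (λ j → cong (_* Q j) (Riordan·lagrangeMatrix≈Id n j))) ⟩
    Id ·ᵥ Q
      ≈⟨ (λ n → ·-identityˡ (λ j _ → Q j) n 0) ⟩
    Q ∎
    where open ≈ₛ-Reasoning

-- The coefficients of c(A; r)

pow-suc⊗powℤ-pred : ∀ f fInv → (f ⊗ fInv) ≈ₛ one → ∀ j r →
  (pow f (suc j) ⊗ powℤ f fInv (+ r - + 1)) ≈ₛ pow f (j ℕ.+ r)
pow-suc⊗powℤ-pred f fInv f⊗fInv≈1 j zero = begin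
  (f ⊗ pow f j) ⊗ (fInv ⊗ one)
    ≈⟨ solve 3 (λ a b c → (a ⊕ b) ⊕ (c ⊕ id) ⊜ (a ⊕ c) ⊕ b) ≈ₛ-refl f (pow f j) fInv ⟩
  (f ⊗ fInv) ⊗ pow f j
    ≈⟨ ⊗-congˡ (pow f j) f⊗fInv≈1 ⟩
  one ⊗ pow f j
    ≈⟨ ⊗-identityˡ (pow f j) ⟩
  pow f j
    ≈⟨ (λ n → cong (λ m → pow f m n) (sym (ℕₚ.+-identityʳ j))) ⟩
  pow f (j ℕ.+ 0) ∎
  where open ≈ₛ-Reasoning
pow-suc⊗powℤ-pred f fInv f⊗fInv≈1 j (suc r) n =
  trans (sym (pow-+ f (suc j) r n)) (cong (λ m → pow f m n) (sym (ℕₚ.+-suc j r)))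

⊗-pow-X⊗f : ∀ g f m → (g ⊗ pow (X ⊗ f) m) ≈ₛ (pow X m ⊗ (g ⊗ pow f m))
⊗-pow-X⊗f g f m = ≈ₛ-trans (⊗-congʳ g (pow-⊗ X f m))
  (solve 3 (λ a b c → a ⊕ (b ⊕ c) ⊜ b ⊕ (a ⊕ c)) ≈ₛ-refl g (pow X m) (pow f m))

lagrange-column-series : ∀ g f fInv → (f ⊗ fInv) ≈ₛ one → ∀ r j k →
  (pow f (suc j) ⊗ (powℤ f fInv (+ r - + 1) ⊗ (g ⊗ pow (X ⊗ f) k)))
    ≈ₛ (pow X k ⊗ (g ⊗ pow f (j ℕ.+ r ℕ.+ k)))
lagrange-column-series g f fInv f⊗fInv≈1 r j k = begin
  pow f (suc j) ⊗ (F ⊗ (g ⊗ pow (X ⊗ f) k))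
    ≈⟨ ⊗-congʳ (pow f (suc j)) (⊗-congʳ F (⊗-pow-X⊗f g f k)) ⟩
  pow f (suc j) ⊗ (F ⊗ (pow X k ⊗ (g ⊗ pow f k)))
    ≈⟨ solve 5 (λ a b c d e → a ⊕ (b ⊕ (c ⊕ (d ⊕ e))) ⊜ c ⊕ (d ⊕ ((a ⊕ b) ⊕ e))) ≈ₛ-refl
         (pow f (suc j)) F (pow X k) g (pow f k) ⟩
  pow X k ⊗ (g ⊗ ((pow f (suc j) ⊗ F) ⊗ pow f k))
    ≈⟨ ⊗-congʳ (pow X k) (⊗-congʳ g (⊗-congˡ (pow f k) (pow-suc⊗powℤ-pred f fInv f⊗fInv≈1 j r))) ⟩
  pow X k ⊗ (g ⊗ (pow f (j ℕ.+ r) ⊗ pow f k))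
    ≈⟨ ⊗-congʳ (pow X k) (⊗-congʳ g (≈ₛ-sym (pow-+ f (j ℕ.+ r) k))) ⟩
  pow X k ⊗ (g ⊗ pow f (j ℕ.+ r ℕ.+ k)) ∎
  where
  open ≈ₛ-Reasoning
  F : Series
  F = powℤ f fInv (+ r - + 1)

cMat-Riordan-coeff : ∀ g f fInv → (f ⊗ fInv) ≈ₛ one → ∀ r j k →
  cMat (Riordan g (X ⊗ f)) r j k
    ≡ (pow f (suc j) ⊗ (powℤ f fInv (+ r - + 1) ⊗ (g ⊗ pow (X ⊗ f) k))) j
cMat-Riordan-coeff g f fInv f⊗fInv≈1 r j k = begin
  (g ⊗ pow (X ⊗ f) (j ℕ.+ k ℕ.+ r)) (2 ℕ.* j ℕ.+ r)
    ≡⟨ cong₂ (λ m i → (g ⊗ pow (X ⊗ f) m) i) (j+k+r≡[j+r]+k j k r) (2j+r≡[j+r]+j j r) ⟩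
  (g ⊗ pow (X ⊗ f) (s ℕ.+ k)) (s ℕ.+ j)
    ≡⟨ ⊗-pow-X⊗f g f (s ℕ.+ k) (s ℕ.+ j) ⟩
  (pow X (s ℕ.+ k) ⊗ (g ⊗ pow f (s ℕ.+ k))) (s ℕ.+ j)
    ≡⟨ powX⊗-shift s k (g ⊗ pow f (s ℕ.+ k)) j ⟩
  (pow X k ⊗ (g ⊗ pow f (s ℕ.+ k))) j
    ≡⟨ sym (lagrange-column-series g f fInv f⊗fInv≈1 r j k j) ⟩
  (pow f (suc j) ⊗ (powℤ f fInv (+ r - + 1) ⊗ (g ⊗ pow (X ⊗ f) k))) j ∎
  where
  open ≡-Reasoning
  s : ℕ
  s = j ℕ.+ r
  j+k+r≡[j+r]+k : ∀ j k r → j ℕ.+ k ℕ.+ r ≡ j ℕ.+ r ℕ.+ k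
  j+k+r≡[j+r]+k = ℕSolver.solve-∀
  2j+r≡[j+r]+j : ∀ j r → 2 ℕ.* j ℕ.+ r ≡ j ℕ.+ r ℕ.+ j
  2j+r≡[j+r]+j = ℕSolver.solve-∀

X⊗inverse⊗f≈X : ∀ f fInv → (f ⊗ fInv) ≈ₛ one → ((X ⊗ fInv) ⊗ f) ≈ₛ X
X⊗inverse⊗f≈X f fInv f⊗fInv≈1 = begin
  (X ⊗ fInv) ⊗ f    ≈⟨ solve 3 (λ a b c → (a ⊕ b) ⊕ c ⊜ a ⊕ (c ⊕ b)) ≈ₛ-refl X fInv f ⟩
  X ⊗ (f ⊗ fInv)    ≈⟨ ⊗-congʳ X f⊗fInv≈1 ⟩
  X ⊗ one           ≈⟨ ⊗-identityʳ X ⟩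
  X                 ∎
  where open ≈ₛ-Reasoning

inverse-const : ∀ f fInv → f 0 ≡ + 1 → (f ⊗ fInv) ≈ₛ one → fInv 0 ≡ + 1
inverse-const f fInv f0 f⊗fInv≈1 =
  trans (sym (ℤₚ.*-identityˡ (fInv 0))) (trans (cong (_* fInv 0) (sym f0)) (f⊗fInv≈1 0))

Riordan·cMat≈Riordan : ∀ g f fInv φ r d → f 0 ≡ + 1 → (f ⊗ fInv) ≈ₛ one →
  φ 0 ≡ + 0 → compose (X ⊗ fInv) φ ≈ₛ X →
  (d ⊗ (compose (deriv φ) (X ⊗ fInv) ⊗ powℤ f fInv (+ r - + 1))) ≈ₛ one →
  (Riordan d (X ⊗ fInv) · cMat (Riordan g (X ⊗ f)) r) ≈ₘ Riordan g (X ⊗ f)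
Riordan·cMat≈Riordan g f fInv φ r d f0 f⊗fInv≈1 φ0 h∘φ≈X d⊗[P⊗F]≈1 n k =
  trans (Riordan-·ᵥ d h Cₖ refl n) (d⊗Cₖ[h]≈Tₖ n)
  where
  open ≈ₛ-Reasoning
  h1 : (X ⊗ fInv) 1 ≡ + 1
  h1 = trans (X⊗-suc fInv 0) (inverse-const f fInv f0 f⊗fInv≈1)
  h F P Tₖ Cₖ : Series
  h  = X ⊗ fInv
  F  = powℤ f fInv (+ r - + 1)
  P  = compose (deriv φ) h
  Tₖ = g ⊗ pow (X ⊗ f) k
  Cₖ = λ j → cMat (Riordan g (X ⊗ f)) r j k

  h′⊗Cₖ[h]≈F⊗Tₖ : (deriv h ⊗ compose Cₖ h) ≈ₛ (F ⊗ Tₖ)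
  h′⊗Cₖ[h]≈F⊗Tₖ = begin
    deriv h ⊗ compose Cₖ h
      ≈⟨ ⊗-congʳ (deriv h) (compose-congˡ h (λ j → trans
           (cMat-Riordan-coeff g f fInv f⊗fInv≈1 r j k) (sym (lagrangeMatrix-·ᵥ f (F ⊗ Tₖ) j)))) ⟩
    deriv h ⊗ compose (lagrangeMatrix f ·ᵥ (F ⊗ Tₖ)) h
      ≈⟨ Lagrange.lagrange-inversion f h f0 (X⊗inverse⊗f≈X f fInv f⊗fInv≈1) (F ⊗ Tₖ) ⟩
    F ⊗ Tₖ ∎

  d⊗Cₖ[h]≈Tₖ : (d ⊗ compose Cₖ h) ≈ₛ Tₖ
  d⊗Cₖ[h]≈Tₖ = begin
    d ⊗ compose Cₖ h
      ≈⟨ ≈ₛ-sym (≈ₛ-trans (⊗-congʳ (d ⊗ compose Cₖ h) (deriv-reversion h φ refl h1 φ0 h∘φ≈X))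
                          (⊗-identityʳ (d ⊗ compose Cₖ h))) ⟩
    (d ⊗ compose Cₖ h) ⊗ (P ⊗ deriv h)
      ≈⟨ solve 4 (λ a b c e → (a ⊕ b) ⊕ (c ⊕ e) ⊜ (a ⊕ c) ⊕ (e ⊕ b)) ≈ₛ-refl d (compose Cₖ h) P (deriv h) ⟩
    (d ⊗ P) ⊗ (deriv h ⊗ compose Cₖ h)
      ≈⟨ ⊗-congʳ (d ⊗ P) h′⊗Cₖ[h]≈F⊗Tₖ ⟩
    (d ⊗ P) ⊗ (F ⊗ Tₖ)
      ≈⟨ solve 4 (λ a b c e → (a ⊕ b) ⊕ (c ⊕ e) ⊜ (a ⊕ (b ⊕ c)) ⊕ e) ≈ₛ-refl d P F Tₖ ⟩
    (d ⊗ (P ⊗ F)) ⊗ Tₖ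
      ≈⟨ ⊗-congˡ Tₖ d⊗[P⊗F]≈1 ⟩
    one ⊗ Tₖ
      ≈⟨ ⊗-identityˡ Tₖ ⟩
    Tₖ ∎

mainTheorem15 :
    (g f : Series) → g 0 ≡ + 1 → f 0 ≡ + 1 →
    (fInv : Series) → (f ⊗ fInv) ≈ₛ one →
    (φ : Series) → φ 0 ≡ + 0 → compose (X ⊗ fInv) φ ≈ₛ X →
    (r : ℕ) →
    (d : Series) →
    (d ⊗ (compose (deriv φ) (X ⊗ fInv) ⊗ powℤ f fInv ((+ r) - (+ 1)))) ≈ₛ one →
    (Minv : Matrix) → LowerTriangular Minv →
    (Minv · Riordan d (X ⊗ fInv)) ≈ₘ Id →
    (Riordan d (X ⊗ fInv) · Minv) ≈ₘ Id →
    cMat (Riordan g (X ⊗ f)) r ≈ₘ (Minv · Riordan g (X ⊗ f))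
mainTheorem15 g f _ f0 fInv f⊗fInv≈1 φ φ0 h∘φ≈X r d d-normalised Minv _ Minv·M≈Id _ =
  inverse-unique (Riordan d (X ⊗ fInv)) Minv (cMat (Riordan g (X ⊗ f)) r) (Riordan g (X ⊗ f))
    (Riordan-lower d (X ⊗ fInv) refl) Minv·M≈Id
    (Riordan·cMat≈Riordan g f fInv φ r d f0 f⊗fInv≈1 φ0 h∘φ≈X d-normalised)
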